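{- Let $G$ be a numerical semigroup. Then $G$ is a $2$-permutation numerical semigroup if and only if $G$ is one of $\langle 1,2\rangle=\mathbb{N}$, $\langle 2,3\rangle=\{0\}\cup\{x\in\mathbb{N}: x\ge 2\}$, or $\langle 3,4\rangle=\{0,3,4\}\cup\{x\in\mathbb{N}: x\ge 6\}$.
   Context: A numerical semigroup is a submonoid $G$ of $(\mathbb{N},+,0)$ with $\mathbb{N}\setminus G$ finite; for $S\subseteq\mathbb{N}$, $\langle S\rangle$ denotes the submonoid generated by $S$. Write the elements of $G$ as $0=g_0<g_1<g_2<\cdots$. For $n\in\mathbb{N}$, $n\ge 1$, $G$ is called an $n$-permutation numerical semigroup if $G=\langle g_1,\dots,g_n\rangle$ and, for every integer $k\ge 0$, the $n$-tuple $(g_{kn+1}\bmod n, g_{kn+2}\bmod n,\dots,g_{kn+n}\bmod n)$ contains exactly one representative of each residue class of $\mathbb{Z}/n\mathbb{Z}$. -}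

module Defs where

open import Data.Nat using (ℕ; zero; suc; _+_; _*_; _<_; _≤_; _%_)
open import Data.Fin using (Fin; toℕ)
open import Data.List using (List; []; _∷_; map)
open import Data.List.Membership.Propositional using (_∈_)
open import Data.Product using (Σ; ∃; _×_; _,_)
open import Relation.Binary.PropositionalEquality using (_≡_)
open import Relation.Nullary using (Dec)
open import Function.Bundles using (_⇔_)

-- Represented by its membership predicate (decidable, as any cofinite set
-- classically is); finiteness of the complement is expressed by a bound
-- beyond which every natural number belongs to G.
record NumericalSemigroup : Set₁ where
  field
    _∈G   : ℕ → Set
    dec   : (x : ℕ) → Dec (x ∈G)
    zero∈ : 0 ∈G
    +-closed : ∀ {x y} → x ∈G → y ∈G → (x + y) ∈G
    cofinite : ∃ λ c → ∀ x → c ≤ x → x ∈G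

open NumericalSemigroup public

data ⟨_⟩ (S : List ℕ) : ℕ → Set where
  gen-zero : ⟨ S ⟩ 0
  gen-add  : ∀ {s x} → s ∈ S → ⟨ S ⟩ x → ⟨ S ⟩ (s + x)

_≐_ : NumericalSemigroup → (ℕ → Set) → Set
G ≐ P = ∀ x → (G ∈G) x ⇔ P x

IsEnumeration : NumericalSemigroup → (ℕ → ℕ) → Set
IsEnumeration G g =
  (∀ i → g i < g (suc i)) ×
  (∀ i → (G ∈G) (g i)) ×
  (∀ x → (G ∈G) x → ∃ λ i → g i ≡ x)

block : (ℕ → ℕ) → ℕ → ℕ → List ℕ
block g a zero    = []
block g a (suc n) = g (suc a) ∷ block g (suc a) n

IsPermutationNS : (n : ℕ) → .{{_ : Data.Nat.NonZero n}} → NumericalSemigroup → Set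
IsPermutationNS n G =
  Σ (ℕ → ℕ) λ g → IsEnumeration G g ×
    (G ≐ ⟨ block g 0 n ⟩) ×
    (∀ k → ∀ (r : Fin n) →
       Σ (Fin n) λ i → (g (k * n + suc (toℕ i)) % n ≡ toℕ r) ×
         (∀ (j : Fin n) → g (k * n + suc (toℕ j)) % n ≡ toℕ r → j ≡ i))

-- Write G = ⟨a, b⟩ with a = g₁ < b = g₂ ≤ 2a and put d = b - a. If a is one of d, 2d, 3d then d
-- divides every element of G, so d = 1 and G is ⟨1,2⟩, ⟨2,3⟩ or ⟨3,4⟩. Otherwise a and b lie in
-- one of three open wedges, where they are positive combinations a = pE + qF, b = rE + sF of two
-- positive integers E, F with (p, q), (r, s) fixed by the wedge. Inside a wedge the first eight
-- or ten elements of G are fixed combinations αE + βF, listed in a table and certified by a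
-- finite check; their parities depend only on those of E and F, and for each of the four choices
-- some pair (g₂ₖ₊₁, g₂ₖ₊₂) has equal parities.
module Submission where

open import Data.Empty using (⊥; ⊥-elim)
open import Data.Fin using (Fin; toℕ; fromℕ<)
open import Data.Fin.Patterns using (0F; 1F; 2F)
open import Data.Fin.Properties using (all?; any?; toℕ-fromℕ<)
open import Data.List using (List; []; _∷_; map; length)
open import Data.List.Properties using (map-∘; map-cong)
open import Data.List.Relation.Unary.All as All using (All; []; _∷_)
open import Data.List.Relation.Unary.Any using (here; there)
open import Data.List.Relation.Unary.Linked using (Linked; [-]; _∷_; linked?)
open import Data.Nat
  using (ℕ; zero; suc; _+_; _*_; _%_; _≤_; _<_; _≟_; _≤?_; _<?_; z≤n; s≤s; z<s; s≤s⁻¹; NonZero)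
open import Data.Nat.DivMod using (_mod_; _/_; m≡m%n+[m/n]*n; [m+kn]%n≡m%n; m%n<n)
open import Data.Nat.Divisibility using (_∣_; divides; _∣0; ∣1⇒≡1; ∣m∣n⇒∣m+n; ∣m+n∣m⇒∣n)
open import Data.Nat.Properties
open import Data.Nat.Tactic.RingSolver using (solve-∀)
open import Data.Product using (Σ; ∃; ∃₂; _×_; _,_; proj₁; proj₂)
open import Data.Product.Properties using (≡-dec)
open import Data.Sum using (_⊎_; inj₁; inj₂; [_,_])
open import Data.Unit using (tt)
open import Function using (_∘_)
open import Function.Bundles using (_⇔_; mk⇔; Equivalence)
open import Relation.Binary using (Decidable; tri<; tri≈; tri>)
open import Relation.Binary.PropositionalEquality hiding ([_])
open import Relation.Nullary using (¬_; Dec; yes; no)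
open import Relation.Nullary.Decidable using (toWitness; _×-dec_; _⊎-dec_; ¬?)

open import Defs

split< : ∀ {m n} → m < n → ∃ λ o → n ≡ m + suc o
split< {m} m<n with m≤n⇒∃[o]m+o≡n m<n
... | o , m+1+o≡n = o , trans (sym m+1+o≡n) (sym (+-suc m o))

⟨⟩-divisible : ∀ {S d x} → All (d ∣_) S → ⟨ S ⟩ x → d ∣ x
⟨⟩-divisible {d = d} d∣S gen-zero = d ∣0
⟨⟩-divisible d∣S (gen-add s∈S x∈S) =
  ∣m∣n⇒∣m+n (All.lookup d∣S s∈S) (⟨⟩-divisible d∣S x∈S)

⟨a,b⟩⇒combination : ∀ {a b x} → ⟨ a ∷ b ∷ [] ⟩ x → ∃₂ λ i j → x ≡ i * a + j * b
⟨a,b⟩⇒combination gen-zero = 0 , 0 , refl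
⟨a,b⟩⇒combination {a} {b} (gen-add (here refl) x∈) with ⟨a,b⟩⇒combination x∈
... | i , j , refl = suc i , j , sym (+-assoc a (i * a) (j * b))
⟨a,b⟩⇒combination {a} {b} (gen-add (there (here refl)) x∈) with ⟨a,b⟩⇒combination x∈
... | i , j , refl = i , suc j , shift a b i j
  where
  shift : ∀ a b i j → b + (i * a + j * b) ≡ i * a + (b + j * b)
  shift = solve-∀
⟨a,b⟩⇒combination (gen-add (there (there ())) _)

combination⇒⟨a,b⟩ : ∀ a b i j → ⟨ a ∷ b ∷ [] ⟩ (i * a + j * b)
combination⇒⟨a,b⟩ a b (suc i) j =
  subst ⟨ a ∷ b ∷ [] ⟩ (sym (+-assoc a (i * a) (j * b)))
    (gen-add (here refl) (combination⇒⟨a,b⟩ a b i j))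
combination⇒⟨a,b⟩ a b zero zero = gen-zero
combination⇒⟨a,b⟩ a b zero (suc j) = gen-add (there (here refl)) (combination⇒⟨a,b⟩ a b zero j)

combination-bound : ∀ {a b i j n} → a ≤ b → i * a + j * b < n * a → i + j < n
combination-bound {a} {b} {i} {j} {n} a≤b small = ≰⇒> λ n≤i+j → <⇒≱ small (begin
  n * a           ≤⟨ *-monoˡ-≤ a n≤i+j ⟩
  (i + j) * a     ≡⟨ *-distribʳ-+ a i j ⟩
  i * a + j * a   ≤⟨ +-monoʳ-≤ (i * a) (*-monoʳ-≤ j a≤b) ⟩
  i * a + j * b   ∎)
  where open ≤-Reasoning

-- c and c + 1 both lie in G once c is past the last gap.
generators-coprime : ∀ G {S d} → G ≐ ⟨ S ⟩ → All (d ∣_) S → d ≡ 1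
generators-coprime G {d = d} G≐⟨S⟩ d∣S with cofinite G
... | c , large = ∣1⇒≡1 (∣m+n∣m⇒∣n (d∣ (c + 1) (m≤m+n c 1)) (d∣ c ≤-refl))
  where
  d∣ : ∀ x → c ≤ x → d ∣ x
  d∣ x c≤x = ⟨⟩-divisible d∣S (Equivalence.to (G≐⟨S⟩ x) (large x c≤x))

module Enumeration {G : NumericalSemigroup} {g : ℕ → ℕ} (en : IsEnumeration G g) where

  increasing : ∀ i → g i < g (suc i)
  increasing = proj₁ en

  listed : ∀ i → (G ∈G) (g i)
  listed = proj₁ (proj₂ en)

  exhaustive : ∀ x → (G ∈G) x → ∃ λ i → g i ≡ x
  exhaustive = proj₂ (proj₂ en)

  g-mono-≤ : ∀ {i j} → i ≤ j → g i ≤ g j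
  g-mono-≤ {j = zero} z≤n = ≤-refl
  g-mono-≤ {j = suc j} i≤1+j with m≤n⇒m<n∨m≡n i≤1+j
  ... | inj₁ i<1+j = ≤-trans (g-mono-≤ (s≤s⁻¹ i<1+j)) (<⇒≤ (increasing j))
  ... | inj₂ refl = ≤-refl

  g-least : ∀ {k x} → (G ∈G) x → g k < x → g (suc k) ≤ x
  g-least {k} x∈G gk<x with exhaustive _ x∈G
  ... | j , refl with k <? j
  ... | yes k<j = g-mono-≤ k<j
  ... | no k≮j = ⊥-elim (<⇒≱ gk<x (g-mono-≤ (≮⇒≥ k≮j)))

  g-next : ∀ {k x} → (G ∈G) x → g k < x → (∀ {y} → (G ∈G) y → g k < y → y < x → ⊥) →
           g (suc k) ≡ x
  g-next {k} x∈G gk<x gap =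
    ≤-antisym (g-least x∈G gk<x) (≮⇒≥ λ next<x → gap (listed (suc k)) (increasing k) next<x)

unique-residues⇒injective : ∀ {n} .{{_ : NonZero n}} (v : Fin n → ℕ) →
  (∀ r → Σ (Fin n) λ i → (v i % n ≡ toℕ r) × (∀ j → v j % n ≡ toℕ r → j ≡ i)) →
  ∀ i j → v i % n ≡ v j % n → i ≡ j
unique-residues⇒injective {n} v residues i j vi≡vj with residues (v i mod n)
... | _ , _ , unique = trans (unique i vi≡r) (sym (unique j (trans (sym vi≡vj) vi≡r)))
  where
  vi≡r : v i % n ≡ toℕ (v i mod n)
  vi≡r = sym (toℕ-fromℕ< (m%n<n (v i) n))

data DistinctInPairs : List ℕ → Set where
  []  : DistinctInPairs []
  [-] : ∀ {x} → DistinctInPairs (x ∷ [])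
  _∷_ : ∀ {x y xs} → x ≢ y → DistinctInPairs xs → DistinctInPairs (x ∷ y ∷ xs)

distinctInPairs? : ∀ xs → Dec (DistinctInPairs xs)
distinctInPairs? [] = yes []
distinctInPairs? (x ∷ []) = yes [-]
distinctInPairs? (x ∷ y ∷ xs) with x ≟ y | distinctInPairs? xs
... | yes x≡y | _      = no λ { (x≢y ∷ _) → x≢y x≡y }
... | no x≢y | yes ps = yes (x≢y ∷ ps)
... | no _   | no ¬ps = no λ { (_ ∷ ps) → ¬ps ps }

parities-differ-in-pairs : ∀ {g : ℕ → ℕ} →
  (∀ k (r : Fin 2) → Σ (Fin 2) λ i → (g (k * 2 + suc (toℕ i)) % 2 ≡ toℕ r) ×
     (∀ j → g (k * 2 + suc (toℕ j)) % 2 ≡ toℕ r → j ≡ i)) →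
  ∀ k n → DistinctInPairs (map (_% 2) (block g (k * 2) n))
parities-differ-in-pairs residues k zero = []
parities-differ-in-pairs residues k (suc zero) = [-]
parities-differ-in-pairs {g} residues k (suc (suc n)) =
  pair-differs ∷ parities-differ-in-pairs residues (suc k) n
  where
  pair-differs : g (suc (k * 2)) % 2 ≢ g (suc (suc (k * 2))) % 2
  pair-differs same
    with unique-residues⇒injective (λ i → g (k * 2 + suc (toℕ i))) (residues k) 0F 1F
           (subst₂ (λ x y → g x % 2 ≡ g y % 2) (+-comm 1 (k * 2)) (+-comm 2 (k * 2)) same)
  ... | ()

Point : Set
Point = ℕ × ℕ

-- The point (α , β) stands for αE + βF with E = e + 1 and F = f + 1.
⟦_⟧⟨_,_⟩ : Point → ℕ → ℕ → ℕ
⟦ α , β ⟧⟨ e , f ⟩ = α * suc e + β * suc f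

infix 4 _≼_ _≼?_

_≼_ : Point → Point → Set
(α , β) ≼ (α′ , β′) = α ≤ α′ × β ≤ β′

_≼?_ : Decidable _≼_
(α , β) ≼? (α′ , β′) = α ≤? α′ ×-dec β ≤? β′

size : Point → ℕ
size (α , β) = α + β

combination : Point → Point → ℕ → ℕ → Point
combination (p , q) (r , s) i j = i * p + j * r , i * q + j * s

-- For all positive E and F, ⟦hi⟧ is the element of ⟨⟦u⟧, ⟦v⟧⟩ next after ⟦lo⟧: combinations
-- iu + jv with i, j < 5 are componentwise below lo or above hi, and larger ones exceed 5u ≽ hi.
Step : Point → Point → Point → Point → Set
Step u v lo hi =
  (lo ≼ hi × size lo < size hi) × hi ≼ combination u v 5 0 ×
  (∃₂ λ (i j : Fin 5) → combination u v (toℕ i) (toℕ j) ≡ hi) ×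
  (∀ (i j : Fin 5) → let c = combination u v (toℕ i) (toℕ j) in c ≼ lo ⊎ hi ≼ c)

step? : ∀ u v → Decidable (Step u v)
step? u v lo hi =
  ((lo ≼? hi) ×-dec (size lo <? size hi)) ×-dec (hi ≼? combination u v 5 0) ×-dec
  any? (λ i → any? λ j → ≡-dec _≟_ _≟_ (combination u v (toℕ i) (toℕ j)) hi) ×-dec
  all? (λ i → all? λ j → let c = combination u v (toℕ i) (toℕ j) in (c ≼? lo) ⊎-dec (hi ≼? c))

parity : Fin 2 → Fin 2 → Point → ℕ
parity pe pf (α , β) = (α * toℕ pe + β * toℕ pf) % 2

Certificate : Point → Point → List Point → Set
Certificate u v cs =
  Linked (Step u v) (u ∷ v ∷ cs) ×
  (∀ (pe pf : Fin 2) → ¬ DistinctInPairs (map (parity pe pf) (u ∷ v ∷ cs)))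

certificate? : ∀ u v cs → Dec (Certificate u v cs)
certificate? u v cs =
  linked? (step? u v) (u ∷ v ∷ cs) ×-dec
  all? (λ pe → all? λ pf → ¬? (distinctInPairs? (map (parity pe pf) (u ∷ v ∷ cs))))

-- The elements g₁, g₂, … of G when 1 < b/a < 4/3, 4/3 < b/a < 3/2 and 3/2 < b/a < 2 respectively.
wedge-1-4/3 : Certificate (3 , 1) (4 , 1)
  ((6 , 2) ∷ (7 , 2) ∷ (8 , 2) ∷ (9 , 3) ∷ (10 , 3) ∷ (11 , 3) ∷ (12 , 3) ∷ (12 , 4) ∷ [])
wedge-1-4/3 = toWitness {a? = certificate? _ _ _} tt

wedge-4/3-3/2 : Certificate (3 , 2) (4 , 3)
  ((6 , 4) ∷ (7 , 5) ∷ (8 , 6) ∷ (9 , 6) ∷ (10 , 7) ∷ (11 , 8) ∷ (12 , 8) ∷ (12 , 9) ∷ [])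
wedge-4/3-3/2 = toWitness {a? = certificate? _ _ _} tt

wedge-3/2-2 : Certificate (2 , 1) (3 , 2)
  ((4 , 2) ∷ (5 , 3) ∷ (6 , 3) ∷ (6 , 4) ∷ (7 , 4) ∷ (8 , 4) ∷ [])
wedge-3/2-2 = toWitness {a? = certificate? _ _ _} tt

module Cone (e f : ℕ) where

  ⟦_⟧ : Point → ℕ
  ⟦ c ⟧ = ⟦ c ⟧⟨ e , f ⟩

  ⟦⟧-mono : ∀ {u v} → u ≼ v → ⟦ u ⟧ ≤ ⟦ v ⟧
  ⟦⟧-mono (α≤α′ , β≤β′) = +-mono-≤ (*-monoˡ-≤ (suc e) α≤α′) (*-monoˡ-≤ (suc f) β≤β′)

  ⟦⟧-strict : ∀ {u v} → u ≼ v → size u < size v → ⟦ u ⟧ < ⟦ v ⟧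
  ⟦⟧-strict {α , β} {α′ , β′} (α≤α′ , β≤β′) smaller =
    subst₂ _<_ (sym (split α β e f)) (sym (split α′ β′ e f))
      (+-mono-<-≤ smaller (+-mono-≤ (*-monoˡ-≤ e α≤α′) (*-monoˡ-≤ f β≤β′)))
    where
    split : ∀ α β e f → α * (1 + e) + β * (1 + f) ≡ (α + β) + (α * e + β * f)
    split = solve-∀

  ⟦combination⟧ : ∀ u v i j → ⟦ combination u v i j ⟧ ≡ i * ⟦ u ⟧ + j * ⟦ v ⟧
  ⟦combination⟧ (p , q) (r , s) i j = regroup i j p q r s (suc e) (suc f)
    where
    regroup : ∀ i j p q r s E F →
      (i * p + j * r) * E + (i * q + j * s) * F ≡ i * (p * E + q * F) + j * (r * E + s * F)
    regroup = solve-∀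

  ⟦⟧-parity : ∀ c → ⟦ c ⟧ % 2 ≡ parity (suc e mod 2) (suc f mod 2) c
  ⟦⟧-parity (α , β) = begin
    (α * E + β * F) % 2
      ≡⟨ cong₂ (λ x y → (α * x + β * y) % 2) (m≡m%n+[m/n]*n E 2) (m≡m%n+[m/n]*n F 2) ⟩
    (α * (E % 2 + E / 2 * 2) + β * (F % 2 + F / 2 * 2)) % 2
      ≡⟨ cong (_% 2) (regroup α β (E % 2) (E / 2) (F % 2) (F / 2)) ⟩
    (α * (E % 2) + β * (F % 2) + (α * (E / 2) + β * (F / 2)) * 2) % 2
      ≡⟨ [m+kn]%n≡m%n (α * (E % 2) + β * (F % 2)) (α * (E / 2) + β * (F / 2)) 2 ⟩
    (α * (E % 2) + β * (F % 2)) % 2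
      ≡⟨ cong₂ (λ x y → (α * x + β * y) % 2) (toℕ-fromℕ< (m%n<n E 2))
                                               (toℕ-fromℕ< (m%n<n F 2)) ⟨
    parity (E mod 2) (F mod 2) (α , β) ∎
    where
    open ≡-Reasoning
    E = suc e
    F = suc f
    regroup : ∀ α β x y z w →
      α * (x + y * 2) + β * (z + w * 2) ≡ α * x + β * z + (α * y + β * w) * 2
    regroup = solve-∀

  step-gap : ∀ {u v lo hi y} → ⟦ u ⟧ ≤ ⟦ v ⟧ → Step u v lo hi →
             ⟨ ⟦ u ⟧ ∷ ⟦ v ⟧ ∷ [] ⟩ y → ⟦ lo ⟧ < y → y < ⟦ hi ⟧ → ⊥
  step-gap {u} {v} {lo} {hi} a≤b (_ , hi≼5u , _ , separated) y∈ lo<y y<hi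
    with ⟨a,b⟩⇒combination y∈
  ... | i , j , refl =
    [ (λ c≼lo → <⇒≱ lo<y (subst (_≤ ⟦ lo ⟧) (⟦combination⟧ u v i j) (⟦⟧-mono c≼lo)))
    , (λ hi≼c → <⇒≱ y<hi (subst (⟦ hi ⟧ ≤_) (⟦combination⟧ u v i j) (⟦⟧-mono hi≼c)))
    ] separated′
    where
    y<5a : i * ⟦ u ⟧ + j * ⟦ v ⟧ < 5 * ⟦ u ⟧
    y<5a = <-≤-trans y<hi (≤-trans (⟦⟧-mono hi≼5u)
             (≤-reflexive (trans (⟦combination⟧ u v 5 0) (+-identityʳ (5 * ⟦ u ⟧)))))
    i+j<5 : i + j < 5
    i+j<5 = combination-bound {i = i} {j} a≤b y<5a
    i<5 : i < 5
    i<5 = ≤-<-trans (m≤m+n i j) i+j<5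
    j<5 : j < 5
    j<5 = ≤-<-trans (m≤n+m j i) i+j<5
    separated′ : combination u v i j ≼ lo ⊎ hi ≼ combination u v i j
    separated′ = subst₂ (λ i j → combination u v i j ≼ lo ⊎ hi ≼ combination u v i j)
                   (toℕ-fromℕ< i<5) (toℕ-fromℕ< j<5) (separated (fromℕ< i<5) (fromℕ< j<5))

  module _ {G g u v} (en : IsEnumeration G g)
           (G≐ : G ≐ ⟨ ⟦ u ⟧ ∷ ⟦ v ⟧ ∷ [] ⟩) (a≤b : ⟦ u ⟧ ≤ ⟦ v ⟧) where
    open Enumeration {G} {g} en

    block-follows-steps : ∀ k {c cs} → g (suc k) ≡ ⟦ c ⟧ → Linked (Step u v) (c ∷ cs) →
           block g k (suc (length cs)) ≡ map ⟦_⟧ (c ∷ cs)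
    block-follows-steps k gk≡ [-] = cong (_∷ []) gk≡
    block-follows-steps k {c} {c′ ∷ _} gk≡
                        (step@((c≼c′ , c<c′) , _ , (i , j , c′≡) , _) ∷ linked) =
      cong₂ _∷_ gk≡ (block-follows-steps (suc k) (g-next c′∈G gk<c′ gap) linked)
      where
      c′∈G : (G ∈G) ⟦ c′ ⟧
      c′∈G = Equivalence.from (G≐ ⟦ c′ ⟧)
        (subst ⟨ ⟦ u ⟧ ∷ ⟦ v ⟧ ∷ [] ⟩
          (trans (sym (⟦combination⟧ u v (toℕ i) (toℕ j))) (cong ⟦_⟧ c′≡))
          (combination⇒⟨a,b⟩ _ _ (toℕ i) (toℕ j)))
      gk<c′ : g (suc k) < ⟦ c′ ⟧
      gk<c′ = subst (_< ⟦ c′ ⟧) (sym gk≡) (⟦⟧-strict c≼c′ c<c′)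
      gap : ∀ {y} → (G ∈G) y → g (suc k) < y → y < ⟦ c′ ⟧ → ⊥
      gap y∈G gk<y = step-gap a≤b step (Equivalence.to (G≐ _) y∈G) (subst (_< _) gk≡ gk<y)

    wedge-impossible : ∀ {cs} → g 1 ≡ ⟦ u ⟧ →
                       (∀ n → DistinctInPairs (map (_% 2) (block g 0 n))) → Certificate u v cs → ⊥
    wedge-impossible {cs} g1≡ pairs (linked , obstructed) =
      obstructed (suc e mod 2) (suc f mod 2) (subst DistinctInPairs listed-parities (pairs _))
      where
      open ≡-Reasoning
      listed-parities : map (_% 2) (block g 0 (length (u ∷ v ∷ cs))) ≡
                        map (parity (suc e mod 2) (suc f mod 2)) (u ∷ v ∷ cs)
      listed-parities = begin
        map (_% 2) (block g 0 (length (u ∷ v ∷ cs)))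
          ≡⟨ cong (map (_% 2)) (block-follows-steps 0 g1≡ linked) ⟩
        map (_% 2) (map ⟦_⟧ (u ∷ v ∷ cs))
          ≡⟨ map-∘ (u ∷ v ∷ cs) ⟨
        map ((_% 2) ∘ ⟦_⟧) (u ∷ v ∷ cs)
          ≡⟨ map-cong ⟦⟧-parity (u ∷ v ∷ cs) ⟩
        map (parity (suc e mod 2) (suc f mod 2)) (u ∷ v ∷ cs) ∎

data Shape (a d : ℕ) : Set where
  ratio : (k : Fin 3) → a ≡ suc (toℕ k) * d → Shape a d
  wedge : ∀ e f {u v cs} → Certificate u v cs →
          a ≡ ⟦ u ⟧⟨ e , f ⟩ → a + d ≡ ⟦ v ⟧⟨ e , f ⟩ → Shape a d

between-multiples : ∀ k {a d} → k * d < a → a < suc k * d →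
  ∃₂ λ e f → a ≡ ⟦ suc k , k ⟧⟨ e , f ⟩ × a + d ≡ ⟦ 2 + k , suc k ⟧⟨ e , f ⟩
between-multiples k {d = d} kd<a a<skd with split< kd<a
... | e , refl with split< a<skd
... | f , skd≡ with +-cancelˡ-≡ (k * d) d (suc e + suc f)
                    (trans (+-comm (k * d) d) (trans skd≡ (+-assoc (k * d) (suc e) (suc f))))
... | refl = e , f , lower k (suc e) (suc f) , upper k (suc e) (suc f)
  where
  lower : ∀ k E F → k * (E + F) + E ≡ (1 + k) * E + k * F
  lower = solve-∀
  upper : ∀ k E F → k * (E + F) + E + (E + F) ≡ (2 + k) * E + (1 + k) * F
  upper = solve-∀

above-multiple : ∀ k {a} o → k * suc o < a →
  ∃ λ f → a ≡ ⟦ k , 1 ⟧⟨ o , f ⟩ × a + suc o ≡ ⟦ suc k , 1 ⟧⟨ o , f ⟩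
above-multiple k o kd<a with split< kd<a
... | f , refl = f , lower k (suc o) (suc f) , upper k (suc o) (suc f)
  where
  lower : ∀ k D F → k * D + F ≡ k * D + 1 * F
  lower = solve-∀
  upper : ∀ k D F → k * D + F + D ≡ (1 + k) * D + 1 * F
  upper = solve-∀

classify : ∀ a o → suc o ≤ a → Shape a (suc o)
classify a o d≤a with <-cmp a (2 * suc o)
... | tri< a<2d _ _ with m≤n⇒m<n∨m≡n d≤a
...   | inj₂ refl = ratio 0F (sym (*-identityˡ a))
...   | inj₁ d<a with between-multiples 1 (subst (_< a) (sym (*-identityˡ (suc o))) d<a) a<2d
...     | e , f , a≡ , b≡ = wedge e f wedge-3/2-2 a≡ b≡
classify a o d≤a | tri≈ _ a≡2d _ = ratio 1F a≡2d
classify a o d≤a | tri> _ _ 2d<a with <-cmp a (3 * suc o)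
... | tri< a<3d _ _ with between-multiples 2 2d<a a<3d
...   | e , f , a≡ , b≡ = wedge e f wedge-4/3-3/2 a≡ b≡
classify a o d≤a | tri> _ _ 2d<a | tri≈ _ a≡3d _ = ratio 2F a≡3d
classify a o d≤a | tri> _ _ 2d<a | tri> _ _ 3d<a with above-multiple 3 o 3d<a
... | f , a≡ , b≡ = wedge o f wedge-1-4/3 a≡ b≡

ConsecutivelyGenerated : NumericalSemigroup → Set
ConsecutivelyGenerated G =
  (G ≐ ⟨ 1 ∷ 2 ∷ [] ⟩) ⊎ (G ≐ ⟨ 2 ∷ 3 ∷ [] ⟩) ⊎ (G ≐ ⟨ 3 ∷ 4 ∷ [] ⟩)

ratio⇒consecutive : ∀ G {a d} m → G ≐ ⟨ a ∷ a + d ∷ [] ⟩ → a ≡ m * d →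
                    G ≐ ⟨ m ∷ suc m ∷ [] ⟩
ratio⇒consecutive G {a} {d} m G≐ a≡md
  with generators-coprime G {d = d} G≐ (divides m a≡md ∷ divides (suc m) b≡ ∷ [])
  where
  b≡ : a + d ≡ suc m * d
  b≡ = trans (cong (_+ d) a≡md) (+-comm (m * d) d)
... | refl = subst₂ (λ a b → G ≐ ⟨ a ∷ b ∷ [] ⟩) a≡m (trans (cong (_+ 1) a≡m) (+-comm m 1)) G≐
  where
  a≡m : a ≡ m
  a≡m = trans a≡md (*-identityʳ m)

consecutive : ∀ {G} (k : Fin 3) → G ≐ ⟨ suc (toℕ k) ∷ suc (suc (toℕ k)) ∷ [] ⟩ →
              ConsecutivelyGenerated G
consecutive 0F G≐ = inj₁ G≐
consecutive 1F G≐ = inj₂ (inj₁ G≐)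
consecutive 2F G≐ = inj₂ (inj₂ G≐)

module _ (G : NumericalSemigroup) {g : ℕ → ℕ} (en : IsEnumeration G g)
         (G≐ : G ≐ ⟨ g 1 ∷ g 2 ∷ [] ⟩) where
  open Enumeration {G} {g} en

  difference≤first : ∀ {d} → g 2 ≡ g 1 + d → d ≤ g 1
  difference≤first {d} g2≡ = +-cancelˡ-≤ (g 1) d (g 1) (subst (_≤ g 1 + g 1) g2≡
    (g-least (+-closed G (listed 1) (listed 1)) (m<m+n (g 1) (≤-<-trans z≤n (increasing 0)))))

  shape⇒consecutivelyGenerated : ∀ {d} → g 2 ≡ g 1 + d →
    (∀ n → DistinctInPairs (map (_% 2) (block g 0 n))) → Shape (g 1) d → ConsecutivelyGenerated G
  shape⇒consecutivelyGenerated g2≡ _ (ratio k a≡) =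
    consecutive {G} k
      (ratio⇒consecutive G (suc (toℕ k)) (subst (λ b → G ≐ ⟨ g 1 ∷ b ∷ [] ⟩) g2≡ G≐) a≡)
  shape⇒consecutivelyGenerated g2≡ pairs (wedge e f {u} {v} certificate a≡ b≡) =
    ⊥-elim (Cone.wedge-impossible e f {G} {g} {u} {v} en
              (subst₂ (λ a b → G ≐ ⟨ a ∷ b ∷ [] ⟩) a≡ b≡′ G≐)
              (subst₂ _≤_ a≡ b≡′ (<⇒≤ (increasing 1))) a≡ pairs certificate)
    where
    b≡′ : g 2 ≡ ⟦ v ⟧⟨ e , f ⟩
    b≡′ = trans g2≡ b≡

two-permutation⇒consecutivelyGenerated : ∀ G → IsPermutationNS 2 G → ConsecutivelyGenerated G
two-permutation⇒consecutivelyGenerated G (g , en , G≐ , residues)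
  with split< (Enumeration.increasing {G} {g} en 1)
... | o , g2≡ = shape⇒consecutivelyGenerated G en G≐ g2≡ (parities-differ-in-pairs residues 0)
                  (classify (g 1) o (difference≤first G en G≐ g2≡))

consecutive-residues : ∀ x (r : Fin 2) →
  Σ (Fin 2) λ i → ((x + toℕ i) % 2 ≡ toℕ r) × (∀ j → (x + toℕ j) % 2 ≡ toℕ r → j ≡ i)
consecutive-residues 0 0F = 0F , refl , λ { 0F _ → refl ; 1F () }
consecutive-residues 0 1F = 1F , refl , λ { 0F () ; 1F _ → refl }
consecutive-residues 1 0F = 1F , refl , λ { 0F () ; 1F _ → refl }
consecutive-residues 1 1F = 0F , refl , λ { 0F _ → refl ; 1F () }
consecutive-residues (suc (suc x)) r = consecutive-residues x r

consecutive-pairs⇒two-permutation : ∀ {G} g → G ≐ ⟨ g 1 ∷ g 2 ∷ [] ⟩ →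
  (∀ i → g i < g (suc i)) → (∀ i → ⟨ g 1 ∷ g 2 ∷ [] ⟩ (g i)) →
  (∀ x → ⟨ g 1 ∷ g 2 ∷ [] ⟩ x → ∃ λ i → g i ≡ x) →
  (∀ k → g (suc (suc (k * 2))) ≡ suc (g (suc (k * 2)))) → IsPermutationNS 2 G
consecutive-pairs⇒two-permutation g G≐ increasing generated covering pairs =
  g , (increasing , (λ i → Equivalence.from (G≐ (g i)) (generated i))
                  , (λ x x∈G → covering x (Equivalence.to (G≐ x) x∈G)))
    , G≐ , residues
  where
  offset : ∀ k i → g (k * 2 + suc (toℕ i)) ≡ g (suc (k * 2)) + toℕ i
  offset k 0F = trans (cong g (+-comm (k * 2) 1)) (sym (+-identityʳ _))
  offset k 1F = trans (cong g (+-comm (k * 2) 2)) (trans (pairs k) (+-comm 1 _))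
  residues : ∀ k (r : Fin 2) → Σ (Fin 2) λ i → (g (k * 2 + suc (toℕ i)) % 2 ≡ toℕ r) ×
               (∀ j → g (k * 2 + suc (toℕ j)) % 2 ≡ toℕ r → j ≡ i)
  residues k r with consecutive-residues (g (suc (k * 2))) r
  ... | i , i↦r , unique =
    i , trans (cong (_% 2) (offset k i)) i↦r
      , λ j j↦r → unique j (trans (cong (_% 2) (sym (offset k j))) j↦r)

⟨1,2⟩-all : ∀ x → ⟨ 1 ∷ 2 ∷ [] ⟩ x
⟨1,2⟩-all zero = gen-zero
⟨1,2⟩-all (suc x) = gen-add (here refl) (⟨1,2⟩-all x)

⟨2,3⟩-from-2 : ∀ k → ⟨ 2 ∷ 3 ∷ [] ⟩ (2 + k)
⟨2,3⟩-from-2 zero = gen-add (here refl) gen-zero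
⟨2,3⟩-from-2 (suc zero) = gen-add (there (here refl)) gen-zero
⟨2,3⟩-from-2 (suc (suc k)) = gen-add (here refl) (⟨2,3⟩-from-2 k)

⟨2,3⟩-gap : ∀ {x} → ⟨ 2 ∷ 3 ∷ [] ⟩ x → x ≢ 1
⟨2,3⟩-gap gen-zero ()
⟨2,3⟩-gap (gen-add (here refl) _) ()
⟨2,3⟩-gap (gen-add (there (here refl)) _) ()

⟨3,4⟩-from-6 : ∀ k → ⟨ 3 ∷ 4 ∷ [] ⟩ (6 + k)
⟨3,4⟩-from-6 zero = gen-add (here refl) (gen-add (here refl) gen-zero)
⟨3,4⟩-from-6 (suc zero) = gen-add (here refl) (gen-add (there (here refl)) gen-zero)
⟨3,4⟩-from-6 (suc (suc zero)) = gen-add (there (here refl)) (gen-add (there (here refl)) gen-zero)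
⟨3,4⟩-from-6 (suc (suc (suc k))) = gen-add (here refl) (⟨3,4⟩-from-6 k)

⟨3,4⟩-gaps : ∀ {x} → ⟨ 3 ∷ 4 ∷ [] ⟩ x → x ≢ 1 × x ≢ 2 × x ≢ 5
⟨3,4⟩-gaps gen-zero = (λ ()) , (λ ()) , (λ ())
⟨3,4⟩-gaps (gen-add (here refl) x∈) =
  (λ ()) , (λ ()) , λ 3+x≡5 → proj₁ (proj₂ (⟨3,4⟩-gaps x∈)) (+-cancelˡ-≡ 3 _ 2 3+x≡5)
⟨3,4⟩-gaps (gen-add (there (here refl)) x∈) =
  (λ ()) , (λ ()) , λ 4+x≡5 → proj₁ (⟨3,4⟩-gaps x∈) (+-cancelˡ-≡ 4 _ 1 4+x≡5)

enumerate⟨2,3⟩ : ℕ → ℕ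
enumerate⟨2,3⟩ zero = 0
enumerate⟨2,3⟩ (suc i) = 2 + i

enumerate⟨3,4⟩ : ℕ → ℕ
enumerate⟨3,4⟩ 0 = 0
enumerate⟨3,4⟩ 1 = 3
enumerate⟨3,4⟩ 2 = 4
enumerate⟨3,4⟩ (suc (suc (suc i))) = 6 + i

consecutivelyGenerated⇒two-permutation : ∀ G → ConsecutivelyGenerated G → IsPermutationNS 2 G
consecutivelyGenerated⇒two-permutation G (inj₁ G≐) =
  consecutive-pairs⇒two-permutation {G} (λ i → i) G≐ n<1+n ⟨1,2⟩-all
    (λ x _ → x , refl) (λ _ → refl)
consecutivelyGenerated⇒two-permutation G (inj₂ (inj₁ G≐)) =
  consecutive-pairs⇒two-permutation {G} enumerate⟨2,3⟩ G≐ increasing generated covering (λ _ → refl)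
  where
  increasing : ∀ i → enumerate⟨2,3⟩ i < enumerate⟨2,3⟩ (suc i)
  increasing zero = z<s
  increasing (suc i) = n<1+n _
  generated : ∀ i → ⟨ 2 ∷ 3 ∷ [] ⟩ (enumerate⟨2,3⟩ i)
  generated zero = gen-zero
  generated (suc i) = ⟨2,3⟩-from-2 i
  covering : ∀ x → ⟨ 2 ∷ 3 ∷ [] ⟩ x → ∃ λ i → enumerate⟨2,3⟩ i ≡ x
  covering 0 _ = 0 , refl
  covering 1 x∈ = ⊥-elim (⟨2,3⟩-gap x∈ refl)
  covering (suc (suc k)) _ = suc k , refl
consecutivelyGenerated⇒two-permutation G (inj₂ (inj₂ G≐)) =
  consecutive-pairs⇒two-permutation {G} enumerate⟨3,4⟩ G≐ increasing generated covering pairs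
  where
  increasing : ∀ i → enumerate⟨3,4⟩ i < enumerate⟨3,4⟩ (suc i)
  increasing 0 = z<s
  increasing 1 = n<1+n 3
  increasing 2 = s≤s (s≤s (s≤s (s≤s (s≤s z≤n))))
  increasing (suc (suc (suc i))) = n<1+n _
  generated : ∀ i → ⟨ 3 ∷ 4 ∷ [] ⟩ (enumerate⟨3,4⟩ i)
  generated 0 = gen-zero
  generated 1 = gen-add (here refl) gen-zero
  generated 2 = gen-add (there (here refl)) gen-zero
  generated (suc (suc (suc i))) = ⟨3,4⟩-from-6 i
  covering : ∀ x → ⟨ 3 ∷ 4 ∷ [] ⟩ x → ∃ λ i → enumerate⟨3,4⟩ i ≡ x
  covering 0 _ = 0 , refl
  covering 1 x∈ = ⊥-elim (proj₁ (⟨3,4⟩-gaps x∈) refl)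
  covering 2 x∈ = ⊥-elim (proj₁ (proj₂ (⟨3,4⟩-gaps x∈)) refl)
  covering 3 _ = 1 , refl
  covering 4 _ = 2 , refl
  covering 5 x∈ = ⊥-elim (proj₂ (proj₂ (⟨3,4⟩-gaps x∈)) refl)
  covering (suc (suc (suc (suc (suc (suc k)))))) _ = suc (suc (suc k)) , refl
  pairs : ∀ k → enumerate⟨3,4⟩ (suc (suc (k * 2))) ≡ suc (enumerate⟨3,4⟩ (suc (k * 2)))
  pairs zero = refl
  pairs (suc k) = refl

mainTheorem1 : (G : NumericalSemigroup) →
    IsPermutationNS 2 G ⇔
      ((G ≐ ⟨ 1 ∷ 2 ∷ [] ⟩) ⊎ (G ≐ ⟨ 2 ∷ 3 ∷ [] ⟩) ⊎ (G ≐ ⟨ 3 ∷ 4 ∷ [] ⟩))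
mainTheorem1 G = mk⇔ (two-permutation⇒consecutivelyGenerated G) (consecutivelyGenerated⇒two-permutation G)
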